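{- Let $\phi\colon\{0,1\}^*\to\{0,1\}^*$ be a non-erasing morphism that is prolongable on $0$. Then $\phi^\infty(0)$ is almost periodic if and only if at least one of the following holds: (1) $\phi(0)$ contains only 0s; (2) $\phi(1)$ contains $0$; (3) $\phi(1)=\Lambda$; (4) $\phi(1)=1$ and $\phi(0)=0u0$ for some word $u$.
   Context: $\Lambda$ denotes the empty word. A morphism satisfies $\phi(uv)=\phi(u)\phi(v)$; it is non-erasing if $|\phi(a)|\ge1$ for each letter $a$. $\phi$ is prolongable on $0$ if $\phi(0)=0u$ with $\phi^n(u)\ne\Lambda$ for all $n$; then $\phi^\infty(0)=\lim_n\phi^n(0)$ is an infinite sequence. A sequence $x$ is almost periodic if for every factor $u$ of $x$ there is $l$ such that every factor of $x$ of length $l$ contains an occurrence of $u$. No assumption is made that both letters occur in $\phi^\infty(0)$. -}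

module Defs where

open import Data.Nat using (ℕ; zero; suc; _+_; _≤_)
open import Data.List using (List; []; _∷_; _++_; length; concatMap; [_])
open import Data.List.Relation.Unary.All using (All)
open import Data.List.Membership.Propositional using (_∈_)
open import Data.Maybe using (Maybe; just; nothing)
open import Data.Product using (Σ; ∃; ∃-syntax; _×_; _,_)
open import Data.Sum using (_⊎_)
open import Relation.Binary.PropositionalEquality using (_≡_; _≢_)

data Bit : Set where
  b0 b1 : Bit

Word : Set
Word = List Bit

Morphism : Set
Morphism = Bit → Word

apply : Morphism → Word → Word
apply φ w = concatMap φ w

iter : Morphism → ℕ → Word → Word
iter φ zero    w = w
iter φ (suc n) w = apply φ (iter φ n w)

NonErasing : Morphism → Set
NonErasing φ = ∀ a → 1 ≤ length (φ a)

ProlongableOn0 : Morphism → Set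
ProlongableOn0 φ = Σ Word λ u → (φ b0 ≡ b0 ∷ u) × (∀ n → iter φ n u ≢ [])

at : Word → ℕ → Maybe Bit
at []       _       = nothing
at (a ∷ w)  zero    = just a
at (a ∷ w)  (suc i) = at w i

IsLimitOf0 : Morphism → (ℕ → Bit) → Set
IsLimitOf0 φ x = ∀ i → ∃[ N ] (∀ n → N ≤ n → at (iter φ n [ b0 ]) i ≡ just (x i))

window : (ℕ → Bit) → ℕ → ℕ → Word
window x p zero    = []
window x p (suc k) = x p ∷ window x (suc p) k

IsFactor : Word → (ℕ → Bit) → Set
IsFactor u x = ∃[ q ] (window x q (length u) ≡ u)

OccursInWindow : Word → (ℕ → Bit) → ℕ → ℕ → Set
OccursInWindow u x p l = ∃[ q ] (p ≤ q × (q + length u ≤ p + l) × window x q (length u) ≡ u)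

AlmostPeriodic : (ℕ → Bit) → Set
AlmostPeriodic x = ∀ u → IsFactor u x → ∃[ l ] (∀ p → OccursInWindow u x p l)

Cond : Morphism → Set
Cond φ = All (_≡ b0) (φ b0)
       ⊎ (b0 ∈ φ b1)
       ⊎ (φ b1 ≡ [])
       ⊎ ((φ b1 ≡ [ b1 ]) × (∃[ u ] (φ b0 ≡ b0 ∷ (u ++ [ b0 ]))))

-- The limit x = φ^∞(0) is a fixed point of every power Φ = φ^m, so it factors into blocks
-- Φ(x₀) Φ(x₁) Φ(x₂) ⋯, each of length at most |Φ(0)| + |Φ(1)|.  Every factor u of x lies in
-- some φ^n(0).  If φ(1) contains 0, then φ^n(0) lies in φ^(n+1)(c) for both letters c, so u
-- occurs in every block of Φ = φ^(n+1).  If φ(1) = 1 and φ(0) = 0v0, the zeros of x are at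
-- most |v| + 1 apart and u occurs in the block of every zero for Φ = φ^n.  In both cases u
-- recurs with bounded gaps; if φ(0) = 0⋯0 then x = 000⋯.  Conversely, if no condition holds,
-- then φ(1) = 1⋯1 and φ(0) contains a 1, and x contains arbitrarily long runs of 1s, which
-- miss its factor 0: φ^n(1) if |φ(1)| ≥ 2, and the suffix 1^n of φ^n(0) if φ(1) = 1 and
-- φ(0) = 0v1.
module Submission where

open import Defs
open import Function.Bundles using (_⇔_; mk⇔)
open import Data.Nat using (ℕ; zero; suc; _+_; _*_; _∸_; _≤_; _<_; _≤?_; z≤n; s≤s)
open import Data.Nat.Properties
open import Data.List using ([]; _∷_; _++_; length; [_]; replicate; InitLast; initLast; _∷ʳ′_)
open import Data.List.Properties using (++-assoc; ++-identityʳ; length-++; length-replicate; ∷-injective; concatMap-++)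
open import Data.List.Relation.Unary.All using (All; []; _∷_; all?)
open import Data.List.Relation.Unary.All.Properties using (++⁺)
open import Data.List.Relation.Unary.Any using (here; there)
open import Data.List.Membership.Propositional using (_∈_)
open import Data.List.Membership.Propositional.Properties using (∈-∃++)
open import Data.Maybe using (just)
open import Data.Maybe.Properties using (just-injective)
open import Data.Product using (∃; ∃₂; ∃-syntax; _×_; _,_; proj₁; proj₂)
open import Data.Sum using (inj₁; inj₂)
open import Relation.Nullary using (¬_; Dec; yes; no; contradiction)
open import Relation.Binary.PropositionalEquality hiding ([_])

_≟ᵇ_ : (a b : Bit) → Dec (a ≡ b)
b0 ≟ᵇ b0 = yes refl
b0 ≟ᵇ b1 = no λ ()
b1 ≟ᵇ b0 = no λ ()
b1 ≟ᵇ b1 = yes refl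

open import Data.List.Membership.DecPropositional _≟ᵇ_ using (_∈?_)

All-b1-if-b0∉ : ∀ w → ¬ b0 ∈ w → All (_≡ b1) w
All-b1-if-b0∉ []       _    = []
All-b1-if-b0∉ (b0 ∷ w) b0∉w = contradiction (here refl) b0∉w
All-b1-if-b0∉ (b1 ∷ w) b0∉w = refl ∷ All-b1-if-b0∉ w (λ b0∈w → b0∉w (there b0∈w))

b1∈-if-¬All-b0 : ∀ w → ¬ All (_≡ b0) w → b1 ∈ w
b1∈-if-¬All-b0 []       ¬all = contradiction [] ¬all
b1∈-if-¬All-b0 (b0 ∷ w) ¬all = there (b1∈-if-¬All-b0 w (λ all → ¬all (refl ∷ all)))
b1∈-if-¬All-b0 (b1 ∷ w) _    = here refl

All-≡⇒replicate-++ : ∀ {c : Bit} {w} n → All (_≡ c) w → n ≤ length w → ∃ λ z → w ≡ replicate n c ++ z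
All-≡⇒replicate-++ zero    _           _       = _ , refl
All-≡⇒replicate-++ (suc n) (refl ∷ cs) (s≤s n≤) with z , w≡ ← All-≡⇒replicate-++ n cs n≤ =
  z , cong (_ ∷_) w≡

length-replicate-++ : ∀ k (c : Bit) w → length (replicate k c ++ w) ≡ k + length w
length-replicate-++ k c w = trans (length-++ (replicate k c)) (cong (_+ length w) (length-replicate k))

replicate-suc-++ : ∀ k (c : Bit) w → replicate (suc k) c ++ w ≡ replicate k c ++ c ∷ w
replicate-suc-++ zero    c w = refl
replicate-suc-++ (suc k) c w = cong (c ∷_) (replicate-suc-++ k c w)

Infix : Word → Word → Set
Infix v w = ∃₂ λ a b → w ≡ a ++ v ++ b

Infix-trans : ∀ {u v w} → Infix u v → Infix v w → Infix u w
Infix-trans {u} (a , b , refl) (a′ , b′ , refl) = a′ ++ a , b ++ b′ , (begin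
  a′ ++ (a ++ u ++ b) ++ b′   ≡⟨ cong (a′ ++_) (++-assoc a (u ++ b) b′) ⟩
  a′ ++ a ++ (u ++ b) ++ b′   ≡⟨ cong (λ t → a′ ++ a ++ t) (++-assoc u b b′) ⟩
  a′ ++ a ++ u ++ b ++ b′     ≡⟨ sym (++-assoc a′ a _) ⟩
  (a′ ++ a) ++ u ++ b ++ b′   ∎)
  where open ≡-Reasoning

∈⇒Infix : ∀ {a : Bit} {w} → a ∈ w → Infix [ a ] w
∈⇒Infix = ∈-∃++

apply-++ : ∀ φ u v → apply φ (u ++ v) ≡ apply φ u ++ apply φ v
apply-++ = concatMap-++

apply-singleton : ∀ φ c → apply φ [ c ] ≡ φ c
apply-singleton φ c = ++-identityʳ (φ c)

apply-replicate : ∀ {φ c} → φ c ≡ [ c ] → ∀ k → apply φ (replicate k c) ≡ replicate k c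
apply-replicate φc≡c zero    = refl
apply-replicate φc≡c (suc k) = cong₂ _++_ φc≡c (apply-replicate φc≡c k)

apply-All-≡ : ∀ φ {c} → All (_≡ c) (φ c) → ∀ {w} → All (_≡ c) w → All (_≡ c) (apply φ w)
apply-All-≡ φ φc-const []          = []
apply-All-≡ φ φc-const (refl ∷ cs) = ++⁺ φc-const (apply-All-≡ φ φc-const cs)

length-apply-≥ : ∀ {φ} → NonErasing φ → ∀ w → length w ≤ length (apply φ w)
length-apply-≥ ne []      = z≤n
length-apply-≥ {φ} ne (c ∷ w) rewrite length-++ (φ c) {apply φ w} = +-mono-≤ (ne c) (length-apply-≥ ne w)

iter-++ : ∀ φ n u v → iter φ n (u ++ v) ≡ iter φ n u ++ iter φ n v
iter-++ φ zero    u v = refl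
iter-++ φ (suc n) u v = trans (cong (apply φ) (iter-++ φ n u v)) (apply-++ φ (iter φ n u) (iter φ n v))

iter-+ : ∀ φ m n w → iter φ (m + n) w ≡ iter φ m (iter φ n w)
iter-+ φ zero    n w = refl
iter-+ φ (suc m) n w = cong (apply φ) (iter-+ φ m n w)

iter-suc : ∀ φ n w → iter φ (suc n) w ≡ iter φ n (apply φ w)
iter-suc φ zero    w = refl
iter-suc φ (suc n) w = cong (apply φ) (iter-suc φ n w)

iter-[] : ∀ φ n → iter φ n [] ≡ []
iter-[] φ zero    = refl
iter-[] φ (suc n) = cong (apply φ) (iter-[] φ n)

iter-Infix : ∀ φ n {v w} → Infix v w → Infix (iter φ n v) (iter φ n w)
iter-Infix φ n {v} (a , b , refl) =
  iter φ n a , iter φ n b , trans (iter-++ φ n a _) (cong (iter φ n a ++_) (iter-++ φ n v b))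

length-iter-≥ : ∀ {φ} → NonErasing φ → ∀ n w → length w ≤ length (iter φ n w)
length-iter-≥ ne zero    w = ≤-refl
length-iter-≥ {φ} ne (suc n) w = ≤-trans (length-iter-≥ ne n w) (length-apply-≥ ne (iter φ n w))

apply-ends-in : ∀ φ {a : Bit} → (∀ c → ∃ λ z → φ c ≡ z ++ [ a ]) →
                ∀ c w → ∃ λ z → apply φ (c ∷ w) ≡ z ++ [ a ]
apply-ends-in φ ends c [] with z , φc≡ ← ends c = z , trans (apply-singleton φ c) φc≡
apply-ends-in φ {a} ends c (d ∷ w) with z , image≡ ← apply-ends-in φ ends d w =
  φ c ++ z , trans (cong (φ c ++_) image≡) (sym (++-assoc (φ c) z [ a ]))

iter-b1-ones : ∀ {φ} → NonErasing φ → ∀ {v} → φ b1 ≡ b1 ∷ b1 ∷ v → All (_≡ b1) v →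
               ∀ n → ∃ λ w → iter φ n [ b1 ] ≡ b1 ∷ w × All (_≡ b1) w × n ≤ length w
iter-b1-ones ne φ1≡11v v-ones zero = [] , refl , [] , z≤n
iter-b1-ones {φ} ne {v} φ1≡11v v-ones (suc n)
  with w , φⁿ1≡ , w-ones , n≤w ← iter-b1-ones ne φ1≡11v v-ones n =
  b1 ∷ v ++ apply φ w ,
  trans (cong (apply φ) φⁿ1≡) (cong (_++ apply φ w) φ1≡11v) ,
  refl ∷ ++⁺ v-ones (apply-All-≡ φ φ1-ones w-ones) ,
  s≤s (≤-trans n≤w (≤-trans (length-apply-≥ ne w)
    (≤-trans (m≤n+m _ (length v)) (≤-reflexive (sym (length-++ v))))))
  where
  φ1-ones : All (_≡ b1) (φ b1)
  φ1-ones = subst (All (_≡ b1)) (sym φ1≡11v) (refl ∷ refl ∷ v-ones)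

iter-long-ones : ∀ {φ} → NonErasing φ → ∀ {v} → φ b1 ≡ b1 ∷ b1 ∷ v → All (_≡ b1) v →
                 ∀ n → Infix (replicate n b1) (iter φ n [ b1 ])
iter-long-ones ne φ1≡11v v-ones n
  with w , φⁿ1≡ , w-ones , n≤w ← iter-b1-ones ne φ1≡11v v-ones n
  with z , w≡ ← All-≡⇒replicate-++ n w-ones n≤w = [ b1 ] , z , trans φⁿ1≡ (cong (b1 ∷_) w≡)

at-++ˡ : ∀ u v {i} → i < length u → at (u ++ v) i ≡ at u i
at-++ˡ (c ∷ u) v {zero}  _         = refl
at-++ˡ (c ∷ u) v {suc i} (s≤s i<u) = at-++ˡ u v i<u

at-just⇒< : ∀ w i {a} → at w i ≡ just a → i < length w
at-just⇒< (c ∷ w) zero    _  = s≤s z≤n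
at-just⇒< (c ∷ w) (suc i) eq = s≤s (at-just⇒< w i eq)

at-All : ∀ {P : Bit → Set} {w} i {a} → All P w → at w i ≡ just a → P a
at-All zero    (p ∷ _)  refl = p
at-All (suc i) (_ ∷ ps) eq   = at-All i ps eq

at-replicate-++ : ∀ k (c : Bit) w t → at (replicate k c ++ w) (k + t) ≡ at w t
at-replicate-++ zero    c w t = refl
at-replicate-++ (suc k) c w t = at-replicate-++ k c w t

OccursBetween : Word → (ℕ → Bit) → ℕ → ℕ → Set
OccursBetween u x p r = ∃[ q ] (p ≤ q × q + length u ≤ r × window x q (length u) ≡ u)

OccursBetween-mono : ∀ {u x p p′ r r′} → p′ ≤ p → r ≤ r′ →
                     OccursBetween u x p r → OccursBetween u x p′ r′
OccursBetween-mono p′≤p r≤r′ (q , p≤q , q+u≤r , occ) = q , ≤-trans p′≤p p≤q , ≤-trans q+u≤r r≤r′ , occ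

module _ (x : ℕ → Bit) where

  window-++ : ∀ p m n → window x p (m + n) ≡ window x p m ++ window x (p + m) n
  window-++ p zero    n = cong (λ q → window x q n) (sym (+-identityʳ p))
  window-++ p (suc m) n rewrite +-suc p m = cong (x p ∷_) (window-++ (suc p) m n)

  window-snoc : ∀ p i → window x p (suc i) ≡ window x p i ++ [ x (p + i) ]
  window-snoc p zero    = cong (λ q → [ x q ]) (sym (+-identityʳ p))
  window-snoc p (suc i) rewrite +-suc p i = cong (x p ∷_) (window-snoc (suc p) i)

  window-agree : ∀ p w → (∀ i → i < length w → at w i ≡ just (x (p + i))) → window x p (length w) ≡ w
  window-agree p []      _     = refl
  window-agree p (c ∷ w) agree = cong₂ _∷_ head≡ (window-agree (suc p) w agree-tail)
    where
    head≡ : x p ≡ c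
    head≡ = sym (just-injective (trans (agree 0 (s≤s z≤n)) (cong (λ q → just (x q)) (+-identityʳ p))))
    agree-tail : ∀ i → i < length w → at w i ≡ just (x (suc p + i))
    agree-tail i i<w = trans (agree (suc i) (s≤s i<w)) (cong (λ q → just (x q)) (+-suc p i))

  window-++⁻ : ∀ p u v → window x p (length (u ++ v)) ≡ u ++ v →
               window x p (length u) ≡ u × window x (p + length u) (length v) ≡ v
  window-++⁻ p []      v occ = refl , subst (λ q → window x q (length v) ≡ v) (sym (+-identityʳ p)) occ
  window-++⁻ p (c ∷ u) v occ with x≡c , occ′ ← ∷-injective occ
                              with occ-u , occ-v ← window-++⁻ (suc p) u v occ′ =
    cong₂ _∷_ x≡c occ-u , subst (λ q → window x q (length v) ≡ v) (sym (+-suc p (length u))) occ-v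

  window-replicate : ∀ {c} p l → window x p l ≡ replicate l c → ∀ q → p ≤ q → q < p + l → x q ≡ c
  window-replicate p zero    _   q p≤q q<p+0 = contradiction (≤-trans (≤-reflexive (+-identityʳ p)) p≤q) (<⇒≱ q<p+0)
  window-replicate p (suc l) occ q p≤q q<    with xp≡c , occ′ ← ∷-injective occ with m≤n⇒m<n∨m≡n p≤q
  ... | inj₂ refl = xp≡c
  ... | inj₁ p<q  = window-replicate (suc p) l occ′ q p<q (≤-trans q< (≤-reflexive (+-suc p l)))

  window-const : ∀ {c} → (∀ i → x i ≡ c) → ∀ p l → window x p l ≡ replicate l c
  window-const x≡c p zero    = refl
  window-const x≡c p (suc l) = cong₂ _∷_ (x≡c p) (window-const x≡c (suc p) l)

  Infix⇒OccursBetween : ∀ {u w} p → window x p (length w) ≡ w → Infix u w → OccursBetween u x p (p + length w)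
  Infix⇒OccursBetween {u} p occ (a , b , refl) =
    p + length a , m≤m+n p _ , bound ,
    proj₁ (window-++⁻ (p + length a) u b (proj₂ (window-++⁻ p a (u ++ b) occ)))
    where
    bound : p + length a + length u ≤ p + length (a ++ u ++ b)
    bound rewrite length-++ a {u ++ b} | length-++ u {b} | +-assoc p (length a) (length u) =
      +-monoʳ-≤ p (+-monoʳ-≤ (length a) (m≤m+n _ _))

-- Recurrence from a block decomposition

module _ (S : ℕ → ℕ) (B : ℕ) (S-0 : S 0 ≡ 0)
         (S-< : ∀ i → S i < S (suc i)) (S-≤ : ∀ i → S (suc i) ≤ S i + B) where

  private
    S-mono : ∀ i k → S i ≤ S (k + i)
    S-mono i zero    = ≤-refl
    S-mono i (suc k) = ≤-trans (S-mono i k) (<⇒≤ (S-< (k + i)))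

    S-+-≤ : ∀ i k → S (k + i) ≤ S i + k * B
    S-+-≤ i zero    = m≤m+n (S i) 0
    S-+-≤ i (suc k) = ≤-trans (S-≤ (k + i)) (≤-trans (+-monoˡ-≤ B (S-+-≤ i k))
      (≤-reflexive (trans (+-assoc (S i) (k * B) B) (cong (S i +_) (+-comm (k * B) B)))))

    block-containing : ∀ p → ∃ λ i → S i ≤ p × p < S (suc i)
    block-containing zero = 0 , ≤-reflexive S-0 , ≤-trans (s≤s z≤n) (S-< 0)
    block-containing (suc p) with i , Si≤p , p<Si′ ← block-containing p with m≤n⇒m<n∨m≡n p<Si′
    ... | inj₁ p+1<Si′ = i , m≤n⇒m≤1+n Si≤p , p+1<Si′
    ... | inj₂ p+1≡Si′ =
      suc i , ≤-reflexive (sym p+1≡Si′) , ≤-trans (s≤s (≤-reflexive p+1≡Si′)) (S-< (suc i))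

  occurs-in-every-window : ∀ {u x} R →
                           (∀ i → ∃ λ d → d ≤ R × OccursBetween u x (S (d + i)) (S (suc (d + i)))) →
                           ∀ p → OccursInWindow u x p (B + suc R * B)
  occurs-in-every-window R occurs p
    with i , Si≤p , p<Si′ ← block-containing p
    with d , d≤R , occ ← occurs (suc i) =
    OccursBetween-mono (≤-trans (<⇒≤ p<Si′) (S-mono (suc i) d)) upper occ
    where
    open ≤-Reasoning
    upper : S (suc d + suc i) ≤ p + (B + suc R * B)
    upper = begin
      S (suc d + suc i)          ≤⟨ S-+-≤ (suc i) (suc d) ⟩
      S (suc i) + suc d * B      ≤⟨ +-mono-≤ (S-≤ i) (*-monoˡ-≤ B (s≤s d≤R)) ⟩
      S i + B + suc R * B        ≤⟨ +-monoˡ-≤ (suc R * B) (+-monoˡ-≤ B Si≤p) ⟩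
      p + B + suc R * B          ≡⟨ +-assoc p B _ ⟩
      p + (B + suc R * B)        ∎

-- The words 0 1^k₁ 0 1^k₂ ⋯ 0 1^kₙ 0 with every kᵢ ≤ K

data BoundedOneRuns (K : ℕ) : Word → Set where
  end : BoundedOneRuns K [ b0 ]
  run : ∀ {w} k → k ≤ K → BoundedOneRuns K w → BoundedOneRuns K (b0 ∷ replicate k b1 ++ w)

BoundedOneRuns-head : ∀ {K w} → BoundedOneRuns K w → at w 0 ≡ just b0
BoundedOneRuns-head end         = refl
BoundedOneRuns-head (run _ _ _) = refl

BoundedOneRuns-++ : ∀ {K u v} k → k ≤ K → BoundedOneRuns K u → BoundedOneRuns K v →
                    BoundedOneRuns K (u ++ replicate k b1 ++ v)
BoundedOneRuns-++ k k≤K end          rv = run k k≤K rv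
BoundedOneRuns-++ {v = v} k k≤K (run {w} j j≤K ru) rv
  rewrite ++-assoc (replicate j b1) w (replicate k b1 ++ v) = run j j≤K (BoundedOneRuns-++ k k≤K ru rv)

BoundedOneRuns-framed : ∀ {K} k v → k + length v ≤ K → BoundedOneRuns K (b0 ∷ replicate k b1 ++ v ++ [ b0 ])
BoundedOneRuns-framed k []       k+0≤K = run k (≤-trans (m≤m+n k 0) k+0≤K) end
BoundedOneRuns-framed k (b0 ∷ v) k+v≤K =
  run k (≤-trans (m≤m+n k _) k+v≤K) (BoundedOneRuns-framed 0 v (≤-trans (n≤1+n _) (≤-trans (m≤n+m _ k) k+v≤K)))
BoundedOneRuns-framed k (b1 ∷ v) k+v≤K =
  subst (BoundedOneRuns _) (cong (b0 ∷_) (replicate-suc-++ k b1 _))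
    (BoundedOneRuns-framed (suc k) v (≤-trans (≤-reflexive (sym (+-suc k (length v)))) k+v≤K))

apply-BoundedOneRuns : ∀ {φ K} → φ b1 ≡ [ b1 ] → BoundedOneRuns K (φ b0) →
                       ∀ {w} → BoundedOneRuns K w → BoundedOneRuns K (apply φ w)
apply-BoundedOneRuns {φ} φ1≡1 rφ0 end = subst (BoundedOneRuns _) (sym (apply-singleton φ b0)) rφ0
apply-BoundedOneRuns {φ} φ1≡1 rφ0 (run {w} k k≤K rw) =
  subst (BoundedOneRuns _) (sym image) (BoundedOneRuns-++ k k≤K rφ0 (apply-BoundedOneRuns φ1≡1 rφ0 rw))
  where
  image : apply φ (b0 ∷ replicate k b1 ++ w) ≡ φ b0 ++ replicate k b1 ++ apply φ w
  image = cong (φ b0 ++_) (trans (apply-++ φ (replicate k b1) w) (cong (_++ apply φ w) (apply-replicate φ1≡1 k)))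

BoundedOneRuns-zero-ahead : ∀ {K w} → BoundedOneRuns K w → ∀ i → i < length w →
                            ∃ λ d → d ≤ K × at w (i + d) ≡ just b0
BoundedOneRuns-zero-ahead end         zero    _ = 0 , z≤n , refl
BoundedOneRuns-zero-ahead end         (suc i) (s≤s ())
BoundedOneRuns-zero-ahead (run _ _ _) zero    _ = 0 , z≤n , refl
BoundedOneRuns-zero-ahead (run {w} k k≤K rw) (suc i) (s≤s i<) with k ≤? i
... | no k≰i = k ∸ i , ≤-trans (m∸n≤m k i) k≤K ,
  subst (λ j → at (replicate k b1 ++ w) j ≡ just b0) (trans (+-identityʳ k) (sym (m+[n∸m]≡n (<⇒≤ (≰⇒> k≰i)))))
    (trans (at-replicate-++ k b1 w 0) (BoundedOneRuns-head rw))
... | yes k≤i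
  with t , refl ← m≤n⇒∃[o]m+o≡n k≤i
  with d , d≤K , at≡ ← BoundedOneRuns-zero-ahead rw t
                         (+-cancelˡ-< k t (length w) (≤-trans i< (≤-reflexive (length-replicate-++ k b1 w)))) =
  d , d≤K , subst (λ j → at (replicate k b1 ++ w) j ≡ just b0) (sym (+-assoc k t d))
              (trans (at-replicate-++ k b1 w (t + d)) at≡)

-- The limit of φⁿ(0)

module _ (φ : Morphism) (ne : NonErasing φ) (u₀ : Word) (φ0≡0u₀ : φ b0 ≡ b0 ∷ u₀)
         (u₀-nonvanishing : ∀ n → iter φ n u₀ ≢ []) (x : ℕ → Bit) (x-limit : IsLimitOf0 φ x) where

  W : ℕ → Word
  W n = iter φ n [ b0 ]

  W-suc : ∀ n → W (suc n) ≡ W n ++ iter φ n u₀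
  W-suc zero    = trans (apply-singleton φ b0) φ0≡0u₀
  W-suc (suc n) = trans (cong (apply φ) (W-suc n)) (apply-++ φ (W n) (iter φ n u₀))

  length-W : ∀ n → n < length (W n)
  length-W zero    = s≤s z≤n
  length-W (suc n) rewrite W-suc n | length-++ (W n) {iter φ n u₀} =
    ≤-trans (≤-reflexive (+-comm 1 (suc n))) (+-mono-≤ (length-W n) (nonempty (u₀-nonvanishing n)))
    where
    nonempty : ∀ {w : Word} → w ≢ [] → 1 ≤ length w
    nonempty {[]}    w≢[] = contradiction refl w≢[]
    nonempty {_ ∷ _} _    = s≤s z≤n

  W-prefix : ∀ k n → ∃ λ c → W (k + n) ≡ W n ++ c
  W-prefix zero    n = [] , sym (++-identityʳ (W n))
  W-prefix (suc k) n with c , W≡ ← W-prefix k n =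
    c ++ iter φ (k + n) u₀ , trans (W-suc (k + n)) (trans (cong (_++ iter φ (k + n) u₀) W≡) (++-assoc (W n) c _))

  W-at : ∀ n i → i < length (W n) → at (W n) i ≡ just (x i)
  W-at n i i<W with N , converges ← x-limit i with c , W≡ ← W-prefix N n =
    trans (sym (at-++ˡ (W n) c i<W)) (trans (cong (λ w → at w i) (sym W≡)) (converges (N + n) (m≤m+n N n)))

  x-≡-if-at-W : ∀ n i {a} → at (W n) i ≡ just a → x i ≡ a
  x-≡-if-at-W n i at≡ = just-injective (trans (sym (W-at n i (at-just⇒< (W n) i at≡))) at≡)

  W-window : ∀ n → window x 0 (length (W n)) ≡ W n
  W-window n = window-agree x 0 (W n) (W-at n)

  window-prefix-W : ∀ k → ∃ λ c → W k ≡ window x 0 k ++ c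
  window-prefix-W k = window x k (length (W k) ∸ k) ,
    trans (sym (W-window k)) (trans (cong (window x 0) (sym (m+[n∸m]≡n (<⇒≤ (length-W k))))) (window-++ x 0 k _))

  factor⇒Infix-W : ∀ u → IsFactor u x → ∃ λ n → Infix u (W n)
  factor⇒Infix-W u (q , occ) with c , W≡ ← window-prefix-W (q + length u) =
    q + length u , window x 0 q , c ,
    trans W≡ (trans (cong (_++ c) (trans (window-++ x 0 q (length u)) (cong (window x 0 q ++_) occ)))
                    (++-assoc (window x 0 q) u c))

  Infix-W⇒factor : ∀ {u} n → Infix u (W n) → IsFactor u x
  Infix-W⇒factor n u⊑W with q , _ , _ , occ ← Infix⇒OccursBetween x 0 (W-window n) u⊑W = q , occ

  module Blocks (m : ℕ) where

    Φ : Word → Word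
    Φ = iter φ m

    S : ℕ → ℕ
    S i = length (Φ (window x 0 i))

    window-S : ∀ i → window x 0 (S i) ≡ Φ (window x 0 i)
    window-S i with c , W≡ ← window-prefix-W i =
      proj₁ (window-++⁻ x 0 (Φ (window x 0 i)) (Φ c)
        (subst (λ w → window x 0 (length w) ≡ w) W≡′ (W-window (m + i))))
      where
      W≡′ : W (m + i) ≡ Φ (window x 0 i) ++ Φ c
      W≡′ = trans (iter-+ φ m i [ b0 ]) (trans (cong Φ W≡) (iter-++ φ m _ c))

    Φ-window-suc : ∀ i → Φ (window x 0 (suc i)) ≡ Φ (window x 0 i) ++ Φ [ x i ]
    Φ-window-suc i = trans (cong Φ (window-snoc x 0 i)) (iter-++ φ m _ _)

    S-suc : ∀ i → S (suc i) ≡ S i + length (Φ [ x i ])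
    S-suc i = trans (cong length (Φ-window-suc i)) (length-++ (Φ (window x 0 i)))

    window-block : ∀ i → window x (S i) (length (Φ [ x i ])) ≡ Φ [ x i ]
    window-block i = proj₂ (window-++⁻ x 0 (Φ (window x 0 i)) (Φ [ x i ])
      (subst (λ w → window x 0 (length w) ≡ w) (Φ-window-suc i) (window-S (suc i))))

    occurs-in-block : ∀ {u} i → Infix u (Φ [ x i ]) → OccursBetween u x (S i) (S (suc i))
    occurs-in-block {u} i u⊑Φxi =
      subst (OccursBetween u x (S i)) (sym (S-suc i)) (Infix⇒OccursBetween x (S i) (window-block i) u⊑Φxi)

    S-< : ∀ i → S i < S (suc i)
    S-< i rewrite S-suc i = ≤-trans (≤-reflexive (+-comm 1 (S i))) (+-monoʳ-≤ (S i) (length-iter-≥ ne m [ x i ]))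

    S-≤ : ∀ i → S (suc i) ≤ S i + (length (Φ [ b0 ]) + length (Φ [ b1 ]))
    S-≤ i rewrite S-suc i with x i
    ... | b0 = +-monoʳ-≤ (S i) (m≤m+n _ _)
    ... | b1 = +-monoʳ-≤ (S i) (m≤n+m _ _)

    recurs-if-in-blocks : ∀ {u} R → (∀ i → ∃ λ d → d ≤ R × Infix u (Φ [ x (d + i) ])) →
                          ∃ λ l → ∀ p → OccursInWindow u x p l
    recurs-if-in-blocks R in-blocks = _ , occurs-in-every-window S _ (cong length (iter-[] φ m)) S-< S-≤ R
      λ i → let (d , d≤R , u⊑Φ) = in-blocks i in d , d≤R , occurs-in-block (d + i) u⊑Φ

  almost-periodic-if-φ0-all-b0 : All (_≡ b0) (φ b0) → AlmostPeriodic x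
  almost-periodic-if-φ0-all-b0 φ0-zeros u (q , occ) =
    length u , λ p → p , ≤-refl , ≤-refl ,
      trans (window-const x x≡b0 p _) (trans (sym (window-const x x≡b0 q _)) occ)
    where
    W-zeros : ∀ n → All (_≡ b0) (W n)
    W-zeros zero    = refl ∷ []
    W-zeros (suc n) = apply-All-≡ φ φ0-zeros (W-zeros n)
    x≡b0 : ∀ i → x i ≡ b0
    x≡b0 i = at-All i (W-zeros i) (W-at i i (length-W i))

  almost-periodic-if-b0∈φ1 : b0 ∈ φ b1 → AlmostPeriodic x
  almost-periodic-if-b0∈φ1 b0∈φ1 u u-factor with n , u⊑W ← factor⇒Infix-W u u-factor =
    Blocks.recurs-if-in-blocks (suc n) 0 λ i → 0 , z≤n , Infix-trans u⊑W (W-Infix (x i))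
    where
    b0∈φ : ∀ c → b0 ∈ φ c
    b0∈φ b0 = subst (b0 ∈_) (sym φ0≡0u₀) (here refl)
    b0∈φ b1 = b0∈φ1
    W-Infix : ∀ c → Infix (W n) (iter φ (suc n) [ c ])
    W-Infix c = subst (Infix (W n)) (sym (trans (iter-suc φ n [ c ]) (cong (iter φ n) (apply-singleton φ c))))
      (iter-Infix φ n (∈⇒Infix (b0∈φ c)))

  almost-periodic-if-φ1≡1-φ0≡0v0 : ∀ v → φ b1 ≡ [ b1 ] → φ b0 ≡ b0 ∷ v ++ [ b0 ] → AlmostPeriodic x
  almost-periodic-if-φ1≡1-φ0≡0v0 v φ1≡1 φ0≡0v0 u u-factor with n , u⊑W ← factor⇒Infix-W u u-factor =
    Blocks.recurs-if-in-blocks n (length v) λ i →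
      let (d , d≤v , x≡b0) = x-zero-ahead i
      in d , d≤v , subst (λ c → Infix u (iter φ n [ c ])) (sym x≡b0) u⊑W
    where
    W-runs : ∀ i → BoundedOneRuns (length v) (W i)
    W-runs zero    = end
    W-runs (suc i) = apply-BoundedOneRuns φ1≡1 φ0-runs (W-runs i)
      where
      φ0-runs : BoundedOneRuns (length v) (φ b0)
      φ0-runs = subst (BoundedOneRuns _) (sym φ0≡0v0) (BoundedOneRuns-framed 0 v ≤-refl)
    x-zero-ahead : ∀ i → ∃ λ d → d ≤ length v × x (d + i) ≡ b0
    x-zero-ahead i with d , d≤v , at≡ ← BoundedOneRuns-zero-ahead (W-runs i) i (length-W i) =
      d , d≤v , trans (cong x (+-comm d i)) (x-≡-if-at-W i (i + d) at≡)

  cond⇒almost-periodic : Cond φ → AlmostPeriodic x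
  cond⇒almost-periodic (inj₁ φ0-zeros)                      = almost-periodic-if-φ0-all-b0 φ0-zeros
  cond⇒almost-periodic (inj₂ (inj₁ b0∈φ1))                  = almost-periodic-if-b0∈φ1 b0∈φ1
  -- Condition (3) never holds for a non-erasing morphism.
  cond⇒almost-periodic (inj₂ (inj₂ (inj₁ φ1≡[])))           =
    contradiction (subst (λ w → 1 ≤ length w) φ1≡[] (ne b1)) λ ()
  cond⇒almost-periodic (inj₂ (inj₂ (inj₂ (φ1≡1 , v , φ0≡)))) = almost-periodic-if-φ1≡1-φ0≡0v0 v φ1≡1 φ0≡

  ¬almost-periodic-if-long-ones : (∀ n → IsFactor (replicate n b1) x) → ¬ AlmostPeriodic x
  ¬almost-periodic-if-long-ones ones ap
    with l , recurs ← ap [ b0 ] (0 , W-window 0)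
    with q , ones-at-q ← ones l
    with r , q≤r , r+1≤q+l , b0-at-r ← recurs q =
    contradiction (trans (sym (proj₁ (∷-injective b0-at-r))) x-r≡b1) λ ()
    where
    x-r≡b1 : x r ≡ b1
    x-r≡b1 = window-replicate x q l (subst (λ k → window x q k ≡ replicate l b1) (length-replicate l) ones-at-q)
               r q≤r (≤-trans (≤-reflexive (+-comm 1 r)) r+1≤q+l)

  long-ones-if-φ1≡11v : ∀ v → φ b1 ≡ b1 ∷ b1 ∷ v → All (_≡ b1) v → b1 ∈ φ b0 →
                        ∀ n → Infix (replicate n b1) (W (suc n))
  long-ones-if-φ1≡11v v φ1≡11v v-ones b1∈φ0 n = Infix-trans (iter-long-ones ne φ1≡11v v-ones n)
    (subst (Infix _) (sym (iter-suc φ n [ b0 ]))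
      (iter-Infix φ n (subst (Infix [ b1 ]) (sym (apply-singleton φ b0)) (∈⇒Infix b1∈φ0))))

  W-ends-in-ones : ∀ v → φ b1 ≡ [ b1 ] → φ b0 ≡ b0 ∷ v ++ [ b1 ] →
                   ∀ n → ∃ λ z → W n ≡ b0 ∷ z ++ replicate n b1
  W-ends-in-ones v φ1≡1 φ0≡0v1 = W-ends
    where
    open ≡-Reasoning
    φ-ends-b1 : ∀ c → ∃ λ z → φ c ≡ z ++ [ b1 ]
    φ-ends-b1 b0 = b0 ∷ v , φ0≡0v1
    φ-ends-b1 b1 = [] , φ1≡1
    apply-b0-ends-b1 : ∀ w → ∃ λ z → apply φ (b0 ∷ w) ≡ b0 ∷ z ++ [ b1 ]
    apply-b0-ends-b1 []      = v , trans (apply-singleton φ b0) φ0≡0v1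
    apply-b0-ends-b1 (c ∷ w) with t , image≡ ← apply-ends-in φ φ-ends-b1 c w = v ++ b1 ∷ t , (begin
      φ b0 ++ apply φ (c ∷ w)            ≡⟨ cong₂ _++_ φ0≡0v1 image≡ ⟩
      (b0 ∷ v ++ [ b1 ]) ++ t ++ [ b1 ]  ≡⟨ cong (b0 ∷_) (++-assoc v [ b1 ] (t ++ [ b1 ])) ⟩
      b0 ∷ v ++ b1 ∷ t ++ [ b1 ]         ≡⟨ cong (b0 ∷_) (sym (++-assoc v (b1 ∷ t) [ b1 ])) ⟩
      b0 ∷ (v ++ b1 ∷ t) ++ [ b1 ]       ∎)
    W-ends : ∀ n → ∃ λ z → W n ≡ b0 ∷ z ++ replicate n b1
    W-ends zero = [] , refl
    W-ends (suc n) with z , W≡ ← W-ends n with y , image≡ ← apply-b0-ends-b1 z = y , (begin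
      apply φ (W n)                                  ≡⟨ cong (apply φ) W≡ ⟩
      apply φ (b0 ∷ z ++ replicate n b1)             ≡⟨ apply-++ φ (b0 ∷ z) _ ⟩
      apply φ (b0 ∷ z) ++ apply φ (replicate n b1)   ≡⟨ cong₂ _++_ image≡ (apply-replicate φ1≡1 n) ⟩
      (b0 ∷ y ++ [ b1 ]) ++ replicate n b1           ≡⟨ cong (b0 ∷_) (++-assoc y [ b1 ] _) ⟩
      b0 ∷ y ++ replicate (suc n) b1                 ∎)

  long-ones-if-φ1≡1-φ0≡0v1 : ∀ v → φ b1 ≡ [ b1 ] → φ b0 ≡ b0 ∷ v ++ [ b1 ] →
                             ∀ n → Infix (replicate n b1) (W n)
  long-ones-if-φ1≡1-φ0≡0v1 v φ1≡1 φ0≡0v1 n with z , W≡ ← W-ends-in-ones v φ1≡1 φ0≡0v1 n =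
    b0 ∷ z , [] , trans W≡ (cong (λ t → b0 ∷ z ++ t) (sym (++-identityʳ _)))

  cond-if-φ1≡1 : AlmostPeriodic x → φ b1 ≡ [ b1 ] → ∀ {w} → φ b0 ≡ b0 ∷ w → InitLast w → Cond φ
  cond-if-φ1≡1 _  _    φ0≡0   []          =
    contradiction (proj₂ (∷-injective (trans (sym φ0≡0u₀) φ0≡0))) (u₀-nonvanishing 0)
  cond-if-φ1≡1 _  φ1≡1 φ0≡0v0 (v ∷ʳ′ b0) = inj₂ (inj₂ (inj₂ (φ1≡1 , v , φ0≡0v0)))
  cond-if-φ1≡1 ap φ1≡1 φ0≡0v1 (v ∷ʳ′ b1) = contradiction ap (¬almost-periodic-if-long-ones λ n →
    Infix-W⇒factor n (long-ones-if-φ1≡1-φ0≡0v1 v φ1≡1 φ0≡0v1 n))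

  cond-if-φ1-ones : AlmostPeriodic x → ∀ {w} → φ b1 ≡ w → All (_≡ b1) w → b1 ∈ φ b0 → Cond φ
  cond-if-φ1-ones _  φ1≡[]   []                     _     = inj₂ (inj₂ (inj₁ φ1≡[]))
  cond-if-φ1-ones ap φ1≡1    (refl ∷ [])            _     = cond-if-φ1≡1 ap φ1≡1 φ0≡0u₀ (initLast u₀)
  cond-if-φ1-ones ap φ1≡11v (refl ∷ refl ∷ v-ones) b1∈φ0 =
    contradiction ap (¬almost-periodic-if-long-ones λ n →
      Infix-W⇒factor (suc n) (long-ones-if-φ1≡11v _ φ1≡11v v-ones b1∈φ0 n))

  almost-periodic⇒cond : AlmostPeriodic x → Cond φ
  almost-periodic⇒cond ap with b0 ∈? φ b1 | all? (_≟ᵇ b0) (φ b0)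
  ... | yes b0∈φ1 | _             = inj₂ (inj₁ b0∈φ1)
  ... | no _      | yes φ0-zeros  = inj₁ φ0-zeros
  ... | no b0∉φ1  | no ¬φ0-zeros  =
    cond-if-φ1-ones ap refl (All-b1-if-b0∉ (φ b1) b0∉φ1) (b1∈-if-¬All-b0 (φ b0) ¬φ0-zeros)

corollary3 : (φ : Morphism) → NonErasing φ → ProlongableOn0 φ →
    (x : ℕ → Bit) → IsLimitOf0 φ x → (AlmostPeriodic x ⇔ Cond φ)
corollary3 φ ne (u₀ , φ0≡0u₀ , u₀-nonvanishing) x x-limit =
  mk⇔ (almost-periodic⇒cond φ ne u₀ φ0≡0u₀ u₀-nonvanishing x x-limit)
      (cond⇒almost-periodic φ ne u₀ φ0≡0u₀ u₀-nonvanishing x x-limit)
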